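{- Let $N \geq 1$ and $n \geq 0$ be integers with $2n > N$. Then \[ S_{N}(n) = \sum_{k=0}^{N} \frac{(2n)!}{(2n-k)!}\, 2^{ -k} \binom{N}{k} B_{2n-k}^{(N-k)}. \]
   Context: The generalized (Nörlund) Bernoulli numbers $B_{m}^{(p)}$ are defined by $\sum_{m=0}^{\infty} B_{m}^{(p)} \frac{z^{m}}{m!} = \left( \frac{z}{e^{z}-1}\right)^{p}$ (so $B_m^{(0)}=\delta_{m,0}$), and $B_m = B_m^{(1)}$ are the classical Bernoulli numbers. For integers $N\ge 1$, $n\ge 0$, \[ S_{N}(n) := \sum_{j_1+\cdots+j_N=n} \frac{(2n)!}{(2j_{1})! \cdots (2j_{N})!} B_{2j_{1}}B_{2j_{2}} \cdots B_{2j_{N}}, \] the sum over all $N$-tuples of nonnegative integers $(j_1,\dots,j_N)$ with $j_1+\cdots+j_N=n$. -}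

module Defs where

open import Data.Nat as ℕ using (ℕ; zero; suc; _∸_; _!)
open import Data.Nat.Properties using (_!≢0; m^n≢0)
open import Data.Nat.Combinatorics using (_P_; _C_)
open import Data.Integer using (+_)
open import Data.Rational using (ℚ; 0ℚ; 1ℚ; _+_; _*_; -_; _/_)
open import Data.List using (List; []; _∷_; upTo; map; concatMap; zipWith; foldr)
open import Data.Vec using (Vec; []; _∷_; toList)

sum : List ℚ → ℚ
sum = foldr _+_ 0ℚ

product : List ℚ → ℚ
product = foldr _*_ 1ℚ

PowerSeries : Set
PowerSeries = ℕ → ℚ

_·ₚ_ : PowerSeries → PowerSeries → PowerSeries
(f ·ₚ g) m = sum (map (λ k → f k * g (m ∸ k)) (upTo (suc m)))

oneₚ : PowerSeries
oneₚ zero    = 1ℚ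
oneₚ (suc _) = 0ℚ

_^ₚ_ : PowerSeries → ℕ → PowerSeries
f ^ₚ zero  = oneₚ
f ^ₚ suc p = f ·ₚ (f ^ₚ p)

-- (e^z - 1)/z = Σ_m z^m / (m+1)!
expm1-over-z : PowerSeries
expm1-over-z m = (+ 1) / (suc m !) where instance _ = suc m !≢0

-- Coefficients of the multiplicative inverse of (e^z - 1)/z, i.e. of
-- z/(e^z - 1).  invList m = [a_m , a_{m-1} , … , a_0], where a_0 = 1 and
-- a_{m+1} = - Σ_{i=0}^{m} c_{i+1} a_{m-i}  (c = expm1-over-z, c_0 = 1),
-- which is exactly the condition (c · a) = 1.
invList : ℕ → List ℚ
invList zero    = 1ℚ ∷ []
invList (suc m) =
  (- sum (zipWith (λ i a → expm1-over-z (suc i) * a) (upTo (suc m)) (invList m)))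
    ∷ invList m

headOr0 : List ℚ → ℚ
headOr0 []      = 0ℚ
headOr0 (x ∷ _) = x

z/expm1 : PowerSeries
z/expm1 m = headOr0 (invList m)

-- Nörlund generalized Bernoulli numbers: Σ_m B_m^(p) z^m/m! = (z/(e^z-1))^p
-- bernoulliGen p m = B_m^{(p)}
bernoulliGen : ℕ → ℕ → ℚ
bernoulliGen p m = ((+ (m !)) / 1) * ((z/expm1 ^ₚ p) m)

bernoulli : ℕ → ℚ
bernoulli m = bernoulliGen 1 m

compositions : (N n : ℕ) → List (Vec ℕ N)
compositions zero    zero    = [] ∷ []
compositions zero    (suc _) = []
compositions (suc N) n =
  concatMap (λ j → map (j ∷_) (compositions N (n ∸ j))) (upTo (suc n))

natℚ : ℕ → ℚ
natℚ k = (+ k) / 1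

multinomial2 : (N n : ℕ) → Vec ℕ N → ℚ
multinomial2 N n v =
  natℚ ((2 ℕ.* n) !) * product (map inv-fact (toList v))
  where
  inv-fact : ℕ → ℚ
  inv-fact j = (+ 1) / ((2 ℕ.* j) !) where instance _ = (2 ℕ.* j) !≢0

S : ℕ → ℕ → ℚ
S N n = sum (map (λ v → multinomial2 N n v
                         * product (map (λ j → bernoulli (2 ℕ.* j)) (toList v)))
                 (compositions N n))

RHS : ℕ → ℕ → ℚ
RHS N n = sum (map term (upTo (suc N)))
  where
  term : ℕ → ℚ
  term k = natℚ ((2 ℕ.* n) P k)
         * ((+ 1) / (2 ℕ.^ k))
         * natℚ (N C k)
         * bernoulliGen (N ∸ k) ((2 ℕ.* n) ∸ k)
    where instance _ = m^n≢0 2 k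

-- Let b(z) = z/(eᶻ - 1) = Σ Bₘ zᵐ/m!.  The identity b(-z) = b(z) + z says that
-- b(z) + z/2 is even, so it equals Σⱼ B₂ⱼ z²ʲ/(2j)!, and S_N(n)/(2n)! is the
-- coefficient of z²ⁿ in (z/2 + b(z))^N.  Expanding this power by the binomial
-- theorem, the k-th term contributes 2⁻ᵏ C(N,k) times the coefficient of z²ⁿ⁻ᵏ
-- in b(z)^(N-k), which is B_{2n-k}^{(N-k)}/(2n-k)!.  The identity b(-z) = b(z) + z
-- itself follows from eᶻ b(z) = b(z) + z and from (1 - e⁻ᶻ)/z · eᶻ = (eᶻ - 1)/z,
-- which on coefficients is Σₖ (-1)ᵏ C(m+1,k+1) = 1.
module Submission where

open import Algebra.Bundles using (CommutativeRing; CommutativeSemiring)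
open import Algebra.Structures using (IsCommutativeSemiring)
import Algebra.Construct.Pointwise as Pointwise
import Algebra.Properties.CommutativeSemiring.Binomial as Binomial
open import Data.Fin using (toℕ)
import Data.Integer as ℤ
import Data.Integer.Properties as ℤ
open import Data.List using (List; []; _∷_; map; upTo; applyUpTo; zipWith; concatMap; _++_)
import Data.List.Properties as List
open import Data.Nat as ℕ using (ℕ; zero; suc; _∸_; _<_; _≤_; z≤n; s≤s; NonZero; _!)
import Data.Nat.Properties as ℕ
open import Data.Nat.Combinatorics
  using (_C_; _P_; nCk≡n!/k![n-k]!; k![n∸k]!∣n!; nPk≡n!/[n∸k]!; [n∸k]!k!∣n!)
open import Data.Nat.DivMod using (m/n*n≡m)
open import Data.Nat.Divisibility using (∣-trans; m∣m*n)
open import Data.Rational as ℚ using (ℚ; 0ℚ; 1ℚ; ½; _+_; _*_; -_; toℚᵘ)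
import Data.Rational.Properties as ℚ
import Data.Rational.Unnormalised as ℚᵘ
import Data.Rational.Unnormalised.Properties as ℚᵘ
open import Data.Rational.Solver using (module +-*-Solver)
open import Data.Vec as Vec using (Vec; toList)
import Data.Vec.Functional as Vector
open import Function using (_∘_)
open import Level using (0ℓ)
open import Relation.Binary.PropositionalEquality

open import Defs

open +-*-Solver

-- Natural numbers and their inverses in ℚ

nCk*k![n∸k]!≡n! : ∀ {n k} → k ≤ n → (n C k) ℕ.* (k ! ℕ.* (n ∸ k) !) ≡ n !
nCk*k![n∸k]!≡n! {n} {k} k≤n =
  trans (cong (ℕ._* (k ! ℕ.* (n ∸ k) !)) (nCk≡n!/k![n-k]! k≤n))
        (m/n*n≡m {{k ℕ.!* (n ∸ k) !≢0}} (k![n∸k]!∣n! k≤n))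

nPk*[n∸k]!≡n! : ∀ {n k} → k ≤ n → (n P k) ℕ.* (n ∸ k) ! ≡ n !
nPk*[n∸k]!≡n! {n} {k} k≤n =
  trans (cong (ℕ._* (n ∸ k) !) (nPk≡n!/[n∸k]! k≤n))
        (m/n*n≡m {{(n ∸ k) ℕ.!≢0}} (∣-trans (m∣m*n (k !)) ([n∸k]!k!∣n! k≤n)))

ℚ-commutativeSemiring : CommutativeSemiring 0ℓ 0ℓ
ℚ-commutativeSemiring = CommutativeRing.commutativeSemiring ℚ.+-*-commutativeRing

open import Algebra.Properties.Semiring.Mult (CommutativeSemiring.semiring ℚ-commutativeSemiring)
  using (_×_; ×1-homo-*; ×-assoc-*)
open import Algebra.Definitions.RawSemiring (CommutativeSemiring.rawSemiring ℚ-commutativeSemiring)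
  using (_^_)
open import Algebra.Properties.Semiring.Exp (CommutativeSemiring.semiring ℚ-commutativeSemiring)
  using (^-homo-*)

toℚᵘ-natℚ : ∀ k → toℚᵘ (natℚ k) ℚᵘ.≃ ℚᵘ.mkℚᵘ (ℤ.+ k) 0
toℚᵘ-natℚ k = ℚ.toℚᵘ-fromℚᵘ (ℚᵘ.mkℚᵘ (ℤ.+ k) 0)

natℚ-suc : ∀ k → natℚ (suc k) ≡ 1ℚ + natℚ k
natℚ-suc k = ℚ.toℚᵘ-injective (begin
  toℚᵘ (natℚ (suc k))                   ≈⟨ toℚᵘ-natℚ (suc k) ⟩
  ℚᵘ.mkℚᵘ (ℤ.+ suc k) 0                 ≈⟨ ℚᵘ.*≡* numerators ⟩
  ℚᵘ.1ℚᵘ ℚᵘ.+ ℚᵘ.mkℚᵘ (ℤ.+ k) 0         ≈⟨ ℚᵘ.+-congʳ ℚᵘ.1ℚᵘ (toℚᵘ-natℚ k) ⟨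
  toℚᵘ 1ℚ ℚᵘ.+ toℚᵘ (natℚ k)            ≈⟨ ℚ.toℚᵘ-homo-+ 1ℚ (natℚ k) ⟨
  toℚᵘ (1ℚ + natℚ k)                    ∎)
  where
  open ℚᵘ.≃-Reasoning
  numerators : ℤ.+ suc k ℤ.* ℤ.+ 1 ≡ (ℤ.+ 1 ℤ.* ℤ.+ 1 ℤ.+ ℤ.+ k ℤ.* ℤ.+ 1) ℤ.* ℤ.+ 1
  numerators = cong (ℤ._* ℤ.+ 1) (cong (ℤ._+_ (ℤ.+ 1)) (sym (ℤ.*-identityʳ (ℤ.+ k))))

natℚ≡×1ℚ : ∀ k → natℚ k ≡ k × 1ℚ
natℚ≡×1ℚ zero    = refl
natℚ≡×1ℚ (suc k) = trans (natℚ-suc k) (cong (1ℚ +_) (natℚ≡×1ℚ k))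

natℚ-homo-* : ∀ m n → natℚ (m ℕ.* n) ≡ natℚ m * natℚ n
natℚ-homo-* m n = begin
  natℚ (m ℕ.* n)        ≡⟨ natℚ≡×1ℚ (m ℕ.* n) ⟩
  (m ℕ.* n) × 1ℚ        ≡⟨ ×1-homo-* m n ⟩
  (m × 1ℚ) * (n × 1ℚ)   ≡⟨ cong₂ _*_ (natℚ≡×1ℚ m) (natℚ≡×1ℚ n) ⟨
  natℚ m * natℚ n       ∎
  where open ≡-Reasoning

×≡natℚ* : ∀ k q → k × q ≡ natℚ k * q
×≡natℚ* k q = begin
  k × q          ≡⟨ cong (k ×_) (ℚ.*-identityˡ q) ⟨
  k × (1ℚ * q)   ≡⟨ ×-assoc-* k 1ℚ q ⟨
  (k × 1ℚ) * q   ≡⟨ cong (_* q) (natℚ≡×1ℚ k) ⟨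
  natℚ k * q     ∎
  where open ≡-Reasoning

inv : (d : ℕ) → .{{NonZero d}} → ℚ
inv d = (ℤ.+ 1) ℚ./ d

inv*natℚ≡1 : ∀ d .{{_ : NonZero d}} → inv d * natℚ d ≡ 1ℚ
inv*natℚ≡1 (suc d) = ℚ.toℚᵘ-injective (begin
  toℚᵘ (inv (suc d) * natℚ (suc d))
    ≈⟨ ℚ.toℚᵘ-homo-* (inv (suc d)) (natℚ (suc d)) ⟩
  toℚᵘ (inv (suc d)) ℚᵘ.* toℚᵘ (natℚ (suc d))
    ≈⟨ ℚᵘ.*-cong (ℚ.toℚᵘ-fromℚᵘ (ℚᵘ.mkℚᵘ (ℤ.+ 1) d)) (toℚᵘ-natℚ (suc d)) ⟩
  ℚᵘ.mkℚᵘ (ℤ.+ 1) d ℚᵘ.* ℚᵘ.mkℚᵘ (ℤ.+ suc d) 0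
    ≈⟨ ℚᵘ.*≡* (cong (λ x → ℤ.+ suc x) numerators) ⟩
  ℚᵘ.1ℚᵘ ∎)
  where
  open ℚᵘ.≃-Reasoning
  numerators : (d ℕ.+ 0) ℕ.* 1 ≡ d ℕ.* 1 ℕ.+ 0
  numerators = trans (ℕ.*-identityʳ (d ℕ.+ 0)) (cong (ℕ._+ 0) (sym (ℕ.*-identityʳ d)))

inv-unique : ∀ d .{{_ : NonZero d}} {x} → x * natℚ d ≡ 1ℚ → x ≡ inv d
inv-unique d {x} x*d≡1 = begin
  x                      ≡⟨ ℚ.*-identityʳ x ⟨
  x * 1ℚ                 ≡⟨ cong (x *_) (trans (ℚ.*-comm (natℚ d) (inv d)) (inv*natℚ≡1 d)) ⟨
  x * (natℚ d * inv d)   ≡⟨ ℚ.*-assoc x (natℚ d) (inv d) ⟨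
  (x * natℚ d) * inv d   ≡⟨ cong (_* inv d) x*d≡1 ⟩
  1ℚ * inv d             ≡⟨ ℚ.*-identityˡ (inv d) ⟩
  inv d                  ∎
  where open ≡-Reasoning

inv-homo-* : ∀ m n .{{_ : NonZero m}} .{{_ : NonZero n}} →
             inv (m ℕ.* n) {{ℕ.m*n≢0 m n}} ≡ inv m * inv n
inv-homo-* m n = sym (inv-unique (m ℕ.* n) {{ℕ.m*n≢0 m n}} (begin
  inv m * inv n * natℚ (m ℕ.* n)        ≡⟨ cong (inv m * inv n *_) (natℚ-homo-* m n) ⟩
  inv m * inv n * (natℚ m * natℚ n)
    ≡⟨ solve 4 (λ p q r s → p :* q :* (r :* s) := (p :* r) :* (q :* s)) refl
               (inv m) (inv n) (natℚ m) (natℚ n) ⟩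
  (inv m * natℚ m) * (inv n * natℚ n)   ≡⟨ cong₂ _*_ (inv*natℚ≡1 m) (inv*natℚ≡1 n) ⟩
  1ℚ * 1ℚ                               ≡⟨⟩
  1ℚ                                    ∎))
  where open ≡-Reasoning

inv≡natℚ*inv : ∀ {k d n} .{{_ : NonZero d}} .{{_ : NonZero n}} →
               k ℕ.* d ≡ n → inv d ≡ natℚ k * inv n
inv≡natℚ*inv {k} {d} {n} k*d≡n = sym (inv-unique d (begin
  natℚ k * inv n * natℚ d     ≡⟨ solve 3 (λ x y z → x :* y :* z := y :* (x :* z)) refl (natℚ k) (inv n) (natℚ d) ⟩
  inv n * (natℚ k * natℚ d)   ≡⟨ cong (inv n *_) (natℚ-homo-* k d) ⟨
  inv n * natℚ (k ℕ.* d)      ≡⟨ cong (λ m → inv n * natℚ m) k*d≡n ⟩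
  inv n * natℚ n              ≡⟨ inv*natℚ≡1 n ⟩
  1ℚ                          ∎))
  where open ≡-Reasoning

inv! : ℕ → ℚ
inv! n = inv (n !) {{n ℕ.!≢0}}

inv!-suc*inv!≡C*inv! : ∀ {k m} → k ≤ m →
                       inv! (suc k) * inv! (m ∸ k) ≡ natℚ (suc m C suc k) * inv! (suc m)
inv!-suc*inv!≡C*inv! {k} {m} k≤m = begin
  inv! (suc k) * inv! (m ∸ k)           ≡⟨ inv-homo-* (suc k !) ((m ∸ k) !) ⟨
  inv (suc k ! ℕ.* (m ∸ k) !)           ≡⟨ inv≡natℚ*inv {suc m C suc k} (nCk*k![n∸k]!≡n! (s≤s k≤m)) ⟩
  natℚ (suc m C suc k) * inv! (suc m)   ∎
  where
  open ≡-Reasoning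
  instance
    _ = suc k ℕ.!≢0
    _ = (m ∸ k) ℕ.!≢0
    _ = suc m ℕ.!≢0
    _ = ℕ.m*n≢0 (suc k !) ((m ∸ k) !) {{suc k ℕ.!≢0}} {{(m ∸ k) ℕ.!≢0}}

-- Finite sums

∑ : ℕ → (ℕ → ℚ) → ℚ
∑ zero    f = 0ℚ
∑ (suc n) f = f 0 + ∑ n (f ∘ suc)

sum-map-applyUpTo : ∀ (f : ℕ → ℚ) g n → sum (map f (applyUpTo g n)) ≡ ∑ n (f ∘ g)
sum-map-applyUpTo f g zero    = refl
sum-map-applyUpTo f g (suc n) = cong (f (g 0) +_) (sum-map-applyUpTo f (g ∘ suc) n)

sum-map-upTo : ∀ (f : ℕ → ℚ) n → sum (map f (upTo n)) ≡ ∑ n f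
sum-map-upTo f = sum-map-applyUpTo f (λ k → k)

∑-cong-< : ∀ n {f g : ℕ → ℚ} → (∀ k → k < n → f k ≡ g k) → ∑ n f ≡ ∑ n g
∑-cong-< zero    eq = refl
∑-cong-< (suc n) eq = cong₂ _+_ (eq 0 (s≤s z≤n)) (∑-cong-< n (λ k k<n → eq (suc k) (s≤s k<n)))

∑-cong : ∀ n {f g : ℕ → ℚ} → (∀ k → f k ≡ g k) → ∑ n f ≡ ∑ n g
∑-cong n eq = ∑-cong-< n (λ k _ → eq k)

∑-zero : ∀ n {f : ℕ → ℚ} → (∀ k → k < n → f k ≡ 0ℚ) → ∑ n f ≡ 0ℚ
∑-zero n eq = trans (∑-cong-< n eq) (∑-0ℚ n)
  where
  ∑-0ℚ : ∀ n → ∑ n (λ _ → 0ℚ) ≡ 0ℚ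
  ∑-0ℚ zero    = refl
  ∑-0ℚ (suc n) = trans (ℚ.+-identityˡ _) (∑-0ℚ n)

∑-snoc : ∀ n (f : ℕ → ℚ) → ∑ (suc n) f ≡ ∑ n f + f n
∑-snoc zero    f = ℚ.+-comm (f 0) 0ℚ
∑-snoc (suc n) f = trans (cong (f 0 +_) (∑-snoc n (f ∘ suc))) (sym (ℚ.+-assoc (f 0) _ (f (suc n))))

∑-distrib-+ : ∀ n (f g : ℕ → ℚ) → ∑ n (λ k → f k + g k) ≡ ∑ n f + ∑ n g
∑-distrib-+ zero    f g = refl
∑-distrib-+ (suc n) f g = trans (cong ((f 0 + g 0) +_) (∑-distrib-+ n (f ∘ suc) (g ∘ suc)))
  (solve 4 (λ a b c d → (a :+ b) :+ (c :+ d) := (a :+ c) :+ (b :+ d)) refl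
           (f 0) (g 0) (∑ n (f ∘ suc)) (∑ n (g ∘ suc)))

*-distribˡ-∑ : ∀ n x (f : ℕ → ℚ) → x * ∑ n f ≡ ∑ n (λ k → x * f k)
*-distribˡ-∑ zero    x f = ℚ.*-zeroʳ x
*-distribˡ-∑ (suc n) x f =
  trans (ℚ.*-distribˡ-+ x (f 0) _) (cong (x * f 0 +_) (*-distribˡ-∑ n x (f ∘ suc)))

*-distribʳ-∑ : ∀ n x (f : ℕ → ℚ) → ∑ n f * x ≡ ∑ n (λ k → f k * x)
*-distribʳ-∑ n x f =
  trans (ℚ.*-comm _ x) (trans (*-distribˡ-∑ n x f) (∑-cong n (λ k → ℚ.*-comm x (f k))))

∑-reverse : ∀ n (f : ℕ → ℚ) → ∑ n f ≡ ∑ n (λ k → f (n ∸ suc k))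
∑-reverse zero    f = refl
∑-reverse (suc n) f = begin
  f 0 + ∑ n (f ∘ suc)                     ≡⟨ cong (f 0 +_) (∑-reverse n (f ∘ suc)) ⟩
  f 0 + ∑ n (λ k → f (suc (n ∸ suc k)))   ≡⟨ cong (f 0 +_) (∑-cong-< n (λ k k<n → cong f (sym (ℕ.+-∸-assoc 1 k<n)))) ⟩
  f 0 + ∑ n (λ k → f (n ∸ k))             ≡⟨ ℚ.+-comm (f 0) _ ⟩
  ∑ n (λ k → f (n ∸ k)) + f 0             ≡⟨ cong (λ i → ∑ n (λ k → f (n ∸ k)) + f i) (ℕ.n∸n≡0 n) ⟨
  ∑ n (λ k → f (n ∸ k)) + f (n ∸ n)       ≡⟨ ∑-snoc n (λ k → f (n ∸ k)) ⟨
  ∑ (suc n) (λ k → f (n ∸ k))             ∎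
  where open ≡-Reasoning

∑-swap-triangle : ∀ m (F : ℕ → ℕ → ℚ) →
  ∑ (suc m) (λ k → ∑ (suc k) (λ i → F i k)) ≡ ∑ (suc m) (λ i → ∑ (suc (m ∸ i)) (λ l → F i (i ℕ.+ l)))
∑-swap-triangle zero    F = refl
∑-swap-triangle (suc m) F = begin
  ∑ (suc (suc m)) (λ k → F 0 k + ∑ k (λ i → F (suc i) k))
    ≡⟨ ∑-distrib-+ (suc (suc m)) (F 0) (λ k → ∑ k (λ i → F (suc i) k)) ⟩
  ∑ (suc (suc m)) (F 0) + (0ℚ + ∑ (suc m) (λ k → ∑ (suc k) (λ i → F (suc i) (suc k))))
    ≡⟨ cong (∑ (suc (suc m)) (F 0) +_) (trans (ℚ.+-identityˡ _) (∑-swap-triangle m (λ i k → F (suc i) (suc k)))) ⟩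
  ∑ (suc (suc m)) (F 0) + ∑ (suc m) (λ i → ∑ (suc (m ∸ i)) (λ l → F (suc i) (suc (i ℕ.+ l)))) ∎
  where open ≡-Reasoning

-- The commutative semiring of formal power series

infixl 6 _+ₚ_
_+ₚ_ : PowerSeries → PowerSeries → PowerSeries
(f +ₚ g) m = f m + g m

0ₚ : PowerSeries
0ₚ _ = 0ℚ

·ₚ-coeff : ∀ f g m → (f ·ₚ g) m ≡ ∑ (suc m) (λ k → f k * g (m ∸ k))
·ₚ-coeff f g m = sum-map-upTo (λ k → f k * g (m ∸ k)) (suc m)

·ₚ-cong : ∀ {f f′ g g′} → f ≗ f′ → g ≗ g′ → f ·ₚ g ≗ f′ ·ₚ g′
·ₚ-cong {f} {f′} {g} {g′} f≗f′ g≗g′ m = begin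
  (f ·ₚ g) m                              ≡⟨ ·ₚ-coeff f g m ⟩
  ∑ (suc m) (λ k → f k * g (m ∸ k))       ≡⟨ ∑-cong (suc m) (λ k → cong₂ _*_ (f≗f′ k) (g≗g′ (m ∸ k))) ⟩
  ∑ (suc m) (λ k → f′ k * g′ (m ∸ k))     ≡⟨ ·ₚ-coeff f′ g′ m ⟨
  (f′ ·ₚ g′) m                            ∎
  where open ≡-Reasoning

·ₚ-congˡ : ∀ f {g g′} → g ≗ g′ → f ·ₚ g ≗ f ·ₚ g′
·ₚ-congˡ f = ·ₚ-cong {f} (λ _ → refl)

·ₚ-congʳ : ∀ g {f f′} → f ≗ f′ → f ·ₚ g ≗ f′ ·ₚ g
·ₚ-congʳ g f≗f′ = ·ₚ-cong f≗f′ (λ _ → refl)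

·ₚ-comm : ∀ f g → f ·ₚ g ≗ g ·ₚ f
·ₚ-comm f g m = begin
  (f ·ₚ g) m                                      ≡⟨ ·ₚ-coeff f g m ⟩
  ∑ (suc m) (λ k → f k * g (m ∸ k))               ≡⟨ ∑-reverse (suc m) (λ k → f k * g (m ∸ k)) ⟩
  ∑ (suc m) (λ k → f (m ∸ k) * g (m ∸ (m ∸ k)))   ≡⟨ ∑-cong-< (suc m) swap ⟩
  ∑ (suc m) (λ k → g k * f (m ∸ k))               ≡⟨ ·ₚ-coeff g f m ⟨
  (g ·ₚ f) m                                      ∎
  where
  open ≡-Reasoning
  swap : ∀ k → k < suc m → f (m ∸ k) * g (m ∸ (m ∸ k)) ≡ g k * f (m ∸ k)
  swap k k<1+m = trans (cong (λ i → f (m ∸ k) * g i) (ℕ.m∸[m∸n]≡n (ℕ.≤-pred k<1+m)))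
                       (ℚ.*-comm (f (m ∸ k)) (g k))

·ₚ-identityˡ : ∀ f → oneₚ ·ₚ f ≗ f
·ₚ-identityˡ f m = begin
  (oneₚ ·ₚ f) m                                ≡⟨ ·ₚ-coeff oneₚ f m ⟩
  1ℚ * f m + ∑ m (λ k → 0ℚ * f (m ∸ suc k))
    ≡⟨ cong₂ _+_ (ℚ.*-identityˡ (f m)) (∑-zero m (λ k _ → ℚ.*-zeroˡ (f (m ∸ suc k)))) ⟩
  f m + 0ℚ                                     ≡⟨ ℚ.+-identityʳ (f m) ⟩
  f m                                          ∎
  where open ≡-Reasoning

·ₚ-zeroˡ : ∀ f → 0ₚ ·ₚ f ≗ 0ₚ
·ₚ-zeroˡ f m = trans (·ₚ-coeff 0ₚ f m) (∑-zero (suc m) (λ k _ → ℚ.*-zeroˡ (f (m ∸ k))))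

·ₚ-distribʳ : ∀ h f g → (f +ₚ g) ·ₚ h ≗ (f ·ₚ h) +ₚ (g ·ₚ h)
·ₚ-distribʳ h f g m = begin
  ((f +ₚ g) ·ₚ h) m
    ≡⟨ ·ₚ-coeff (f +ₚ g) h m ⟩
  ∑ (suc m) (λ k → (f k + g k) * h (m ∸ k))
    ≡⟨ ∑-cong (suc m) (λ k → ℚ.*-distribʳ-+ (h (m ∸ k)) (f k) (g k)) ⟩
  ∑ (suc m) (λ k → f k * h (m ∸ k) + g k * h (m ∸ k))
    ≡⟨ ∑-distrib-+ (suc m) (λ k → f k * h (m ∸ k)) (λ k → g k * h (m ∸ k)) ⟩
  ∑ (suc m) (λ k → f k * h (m ∸ k)) + ∑ (suc m) (λ k → g k * h (m ∸ k))
    ≡⟨ cong₂ _+_ (·ₚ-coeff f h m) (·ₚ-coeff g h m) ⟨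
  ((f ·ₚ h) +ₚ (g ·ₚ h)) m ∎
  where open ≡-Reasoning

·ₚ-assoc : ∀ f g h → (f ·ₚ g) ·ₚ h ≗ f ·ₚ (g ·ₚ h)
·ₚ-assoc f g h m = begin
  ((f ·ₚ g) ·ₚ h) m
    ≡⟨ ·ₚ-coeff (f ·ₚ g) h m ⟩
  ∑ (suc m) (λ k → (f ·ₚ g) k * h (m ∸ k))
    ≡⟨ ∑-cong (suc m) expand-left ⟩
  ∑ (suc m) (λ k → ∑ (suc k) (λ i → f i * g (k ∸ i) * h (m ∸ k)))
    ≡⟨ ∑-swap-triangle m (λ i k → f i * g (k ∸ i) * h (m ∸ k)) ⟩
  ∑ (suc m) (λ i → ∑ (suc (m ∸ i)) (λ l → f i * g (i ℕ.+ l ∸ i) * h (m ∸ (i ℕ.+ l))))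
    ≡⟨ ∑-cong (suc m) (λ i → ∑-cong (suc (m ∸ i)) (λ l → reindex i l)) ⟩
  ∑ (suc m) (λ i → ∑ (suc (m ∸ i)) (λ l → f i * (g l * h (m ∸ i ∸ l))))
    ≡⟨ ∑-cong (suc m) expand-right ⟨
  ∑ (suc m) (λ i → f i * (g ·ₚ h) (m ∸ i))
    ≡⟨ ·ₚ-coeff f (g ·ₚ h) m ⟨
  (f ·ₚ (g ·ₚ h)) m ∎
  where
  open ≡-Reasoning
  expand-left : ∀ k → (f ·ₚ g) k * h (m ∸ k) ≡ ∑ (suc k) (λ i → f i * g (k ∸ i) * h (m ∸ k))
  expand-left k = trans (cong (_* h (m ∸ k)) (·ₚ-coeff f g k))
                        (*-distribʳ-∑ (suc k) (h (m ∸ k)) (λ i → f i * g (k ∸ i)))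
  expand-right : ∀ i → f i * (g ·ₚ h) (m ∸ i) ≡ ∑ (suc (m ∸ i)) (λ l → f i * (g l * h (m ∸ i ∸ l)))
  expand-right i = trans (cong (f i *_) (·ₚ-coeff g h (m ∸ i)))
                         (*-distribˡ-∑ (suc (m ∸ i)) (f i) (λ l → g l * h (m ∸ i ∸ l)))
  reindex : ∀ i l → f i * g (i ℕ.+ l ∸ i) * h (m ∸ (i ℕ.+ l)) ≡ f i * (g l * h (m ∸ i ∸ l))
  reindex i l = trans (cong₂ (λ a b → f i * g a * h b) (ℕ.m+n∸m≡n i l) (sym (ℕ.∸-+-assoc m i l)))
                      (ℚ.*-assoc (f i) (g l) _)

open import Algebra.Structures.Biased (_≗_ {A = ℕ} {B = ℚ})
  using (module IsCommutativeSemiringˡ; module IsCommutativeMonoidˡ)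

powerSeries-isCommutativeSemiring : IsCommutativeSemiring _≗_ _+ₚ_ _·ₚ_ 0ₚ oneₚ
powerSeries-isCommutativeSemiring = IsCommutativeSemiringˡ.isCommutativeSemiring record
  { +-isCommutativeMonoid = Pointwise.isCommutativeMonoid ℕ ℚ.+-0-isCommutativeMonoid
  ; *-isCommutativeMonoid = IsCommutativeMonoidˡ.isCommutativeMonoid record
    { isSemigroup = record
      { isMagma = record { isEquivalence = Pointwise.isEquivalence ℕ isEquivalence ; ∙-cong = ·ₚ-cong }
      ; assoc   = ·ₚ-assoc
      }
    ; identityˡ = ·ₚ-identityˡ
    ; comm      = ·ₚ-comm
    }
  ; distribʳ = ·ₚ-distribʳ
  ; zeroˡ    = ·ₚ-zeroˡ
  }

powerSeries : CommutativeSemiring 0ℓ 0ℓ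
powerSeries = record { isCommutativeSemiring = powerSeries-isCommutativeSemiring }

module P = CommutativeSemiring powerSeries

·ₚ-identityʳ : ∀ f → f ·ₚ oneₚ ≗ f
·ₚ-identityʳ = P.*-identityʳ

open import Algebra.Definitions.RawSemiring P.rawSemiring using () renaming (_^_ to _^ᴾ_; _×_ to _×ₚ_)
module ℚ-Binomial = Binomial ℚ-commutativeSemiring
module P-Binomial = Binomial powerSeries

^ᴾ≡^ₚ : ∀ f n → f ^ᴾ n ≡ f ^ₚ n
^ᴾ≡^ₚ f zero    = refl
^ᴾ≡^ₚ f (suc n) = cong (f ·ₚ_) (^ᴾ≡^ₚ f n)

^ₚ-cong : ∀ {f g} → f ≗ g → ∀ n → f ^ₚ n ≗ g ^ₚ n
^ₚ-cong f≗g zero    = λ _ → refl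
^ₚ-cong f≗g (suc n) = ·ₚ-cong f≗g (^ₚ-cong f≗g n)

foldr-+≡∑ : ∀ n (g : ℕ → ℚ) → Vector.foldr _+_ 0ℚ {n} (g ∘ toℕ) ≡ ∑ n g
foldr-+≡∑ zero    g = refl
foldr-+≡∑ (suc n) g = cong (g 0 +_) (foldr-+≡∑ n (g ∘ suc))

foldr-+ₚ-coeff : ∀ n (g : ℕ → PowerSeries) m →
                 Vector.foldr _+ₚ_ 0ₚ {n} (g ∘ toℕ) m ≡ ∑ n (λ k → g k m)
foldr-+ₚ-coeff zero    g m = refl
foldr-+ₚ-coeff (suc n) g m = cong (g 0 m +_) (foldr-+ₚ-coeff n (g ∘ suc) m)

×ₚ-coeff : ∀ k f m → (k ×ₚ f) m ≡ natℚ k * f m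
×ₚ-coeff k f m = trans (pointwise k) (×≡natℚ* k (f m))
  where
  pointwise : ∀ k → (k ×ₚ f) m ≡ k × f m
  pointwise zero    = refl
  pointwise (suc k) = cong (f m +_) (pointwise k)

^ₚ-binomial-coeff : ∀ f g N m →
  ((f +ₚ g) ^ₚ N) m ≡ ∑ (suc N) (λ k → natℚ (N C k) * ((f ^ₚ k) ·ₚ (g ^ₚ (N ∸ k))) m)
^ₚ-binomial-coeff f g N m = begin
  ((f +ₚ g) ^ₚ N) m
    ≡⟨ cong (λ h → h m) (^ᴾ≡^ₚ (f +ₚ g) N) ⟨
  ((f +ₚ g) ^ᴾ N) m
    ≡⟨ P-Binomial.theorem N f g m ⟩
  P-Binomial.binomialExpansion f g N m
    ≡⟨ foldr-+ₚ-coeff (suc N) (λ k → (N C k) ×ₚ ((f ^ᴾ k) ·ₚ (g ^ᴾ (N ∸ k)))) m ⟩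
  ∑ (suc N) (λ k → ((N C k) ×ₚ ((f ^ᴾ k) ·ₚ (g ^ᴾ (N ∸ k)))) m)
    ≡⟨ ∑-cong (suc N) (λ k → ×ₚ-coeff (N C k) ((f ^ᴾ k) ·ₚ (g ^ᴾ (N ∸ k))) m) ⟩
  ∑ (suc N) (λ k → natℚ (N C k) * ((f ^ᴾ k) ·ₚ (g ^ᴾ (N ∸ k))) m)
    ≡⟨ ∑-cong (suc N) (λ k → cong₂ (λ u v → natℚ (N C k) * (u ·ₚ v) m) (^ᴾ≡^ₚ f k) (^ᴾ≡^ₚ g (N ∸ k))) ⟩
  ∑ (suc N) (λ k → natℚ (N C k) * ((f ^ₚ k) ·ₚ (g ^ₚ (N ∸ k))) m) ∎
  where open ≡-Reasoning

1ℚ^≡1ℚ : ∀ n → 1ℚ ^ n ≡ 1ℚ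
1ℚ^≡1ℚ zero    = refl
1ℚ^≡1ℚ (suc n) = cong (1ℚ *_) (1ℚ^≡1ℚ n)

∑-alternating-binomial : ∀ m → ∑ (suc (suc m)) (λ j → (- 1ℚ) ^ j * natℚ (suc m C j)) ≡ 0ℚ
∑-alternating-binomial m = begin
  ∑ (suc n) (λ j → (- 1ℚ) ^ j * natℚ (n C j))
    ≡⟨ ∑-cong (suc n) term ⟩
  ∑ (suc n) (λ j → (n C j) × ((- 1ℚ) ^ j * 1ℚ ^ (n ∸ j)))
    ≡⟨ foldr-+≡∑ (suc n) (λ j → (n C j) × ((- 1ℚ) ^ j * 1ℚ ^ (n ∸ j))) ⟨
  ℚ-Binomial.binomialExpansion (- 1ℚ) 1ℚ n
    ≡⟨ ℚ-Binomial.theorem n (- 1ℚ) 1ℚ ⟨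
  0ℚ * 0ℚ ^ m
    ≡⟨ ℚ.*-zeroˡ (0ℚ ^ m) ⟩
  0ℚ ∎
  where
  open ≡-Reasoning
  n = suc m
  term : ∀ j → (- 1ℚ) ^ j * natℚ (n C j) ≡ (n C j) × ((- 1ℚ) ^ j * 1ℚ ^ (n ∸ j))
  term j = begin
    (- 1ℚ) ^ j * natℚ (n C j)                    ≡⟨ ℚ.*-comm _ (natℚ (n C j)) ⟩
    natℚ (n C j) * (- 1ℚ) ^ j                    ≡⟨ cong (natℚ (n C j) *_) (ℚ.*-identityʳ _) ⟨
    natℚ (n C j) * ((- 1ℚ) ^ j * 1ℚ)             ≡⟨ cong (λ x → natℚ (n C j) * ((- 1ℚ) ^ j * x)) (1ℚ^≡1ℚ (n ∸ j)) ⟨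
    natℚ (n C j) * ((- 1ℚ) ^ j * 1ℚ ^ (n ∸ j))   ≡⟨ ×≡natℚ* (n C j) _ ⟨
    (n C j) × ((- 1ℚ) ^ j * 1ℚ ^ (n ∸ j))        ∎

∑-alternating-C-suc : ∀ m → ∑ (suc m) (λ k → (- 1ℚ) ^ k * natℚ (suc m C suc k)) ≡ 1ℚ
∑-alternating-C-suc m = begin
  s                                              ≡⟨ ℚ.+-identityʳ s ⟨
  s + 0ℚ                                         ≡⟨ cong (s +_) (∑-alternating-binomial m) ⟨
  s + (1ℚ + ∑ (suc m) (λ k → (- 1ℚ) ^ suc k * c k))
    ≡⟨ cong (λ x → s + (1ℚ + x)) (∑-cong (suc m) (λ k → ℚ.*-assoc (- 1ℚ) ((- 1ℚ) ^ k) (c k))) ⟩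
  s + (1ℚ + ∑ (suc m) (λ k → - 1ℚ * ((- 1ℚ) ^ k * c k)))
    ≡⟨ cong (λ x → s + (1ℚ + x)) (*-distribˡ-∑ (suc m) (- 1ℚ) (λ k → (- 1ℚ) ^ k * c k)) ⟨
  s + (1ℚ + - 1ℚ * s)                            ≡⟨ solve 1 (λ x → x :+ (con 1ℚ :+ (:- con 1ℚ) :* x) := con 1ℚ) refl s ⟩
  1ℚ                                             ∎
  where
  open ≡-Reasoning
  c : ℕ → ℚ
  c k = natℚ (suc m C suc k)
  s = ∑ (suc m) (λ k → (- 1ℚ) ^ k * c k)

-- The generating function z/(eᶻ - 1)

infix 8 _·z
_·z : ℚ → PowerSeries
(a ·z) zero          = 0ℚ
(a ·z) (suc zero)    = a
(a ·z) (suc (suc _)) = 0ℚ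

·z≡*1·z : ∀ a m → (a ·z) m ≡ a * (1ℚ ·z) m
·z≡*1·z a zero          = sym (ℚ.*-zeroʳ a)
·z≡*1·z a (suc zero)    = sym (ℚ.*-identityʳ a)
·z≡*1·z a (suc (suc m)) = sym (ℚ.*-zeroʳ a)

·z-·ₚ-zero : ∀ a f → ((a ·z) ·ₚ f) 0 ≡ 0ℚ
·z-·ₚ-zero a f = trans (·ₚ-coeff (a ·z) f 0) (trans (ℚ.+-identityʳ _) (ℚ.*-zeroˡ (f 0)))

·z-·ₚ-suc : ∀ a f m → ((a ·z) ·ₚ f) (suc m) ≡ a * f m
·z-·ₚ-suc a f m = begin
  ((a ·z) ·ₚ f) (suc m)
    ≡⟨ ·ₚ-coeff (a ·z) f (suc m) ⟩
  0ℚ * f (suc m) + (a * f m + ∑ m (λ k → 0ℚ * f (m ∸ suc k)))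
    ≡⟨ cong₂ (λ x y → x + (a * f m + y)) (ℚ.*-zeroˡ (f (suc m))) (∑-zero m (λ k _ → ℚ.*-zeroˡ (f (m ∸ suc k)))) ⟩
  0ℚ + (a * f m + 0ℚ)
    ≡⟨ trans (ℚ.+-identityˡ _) (ℚ.+-identityʳ (a * f m)) ⟩
  a * f m ∎
  where open ≡-Reasoning

·z^ₚ-·ₚ : ∀ a k g j → (((a ·z) ^ₚ k) ·ₚ g) (k ℕ.+ j) ≡ a ^ k * g j
·z^ₚ-·ₚ a zero    g j = trans (·ₚ-identityˡ g j) (sym (ℚ.*-identityˡ (g j)))
·z^ₚ-·ₚ a (suc k) g j = begin
  (((a ·z) ·ₚ ((a ·z) ^ₚ k)) ·ₚ g) (suc (k ℕ.+ j))   ≡⟨ ·ₚ-assoc (a ·z) ((a ·z) ^ₚ k) g (suc (k ℕ.+ j)) ⟩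
  ((a ·z) ·ₚ (((a ·z) ^ₚ k) ·ₚ g)) (suc (k ℕ.+ j))   ≡⟨ ·z-·ₚ-suc a (((a ·z) ^ₚ k) ·ₚ g) (k ℕ.+ j) ⟩
  a * (((a ·z) ^ₚ k) ·ₚ g) (k ℕ.+ j)                  ≡⟨ cong (a *_) (·z^ₚ-·ₚ a k g j) ⟩
  a * (a ^ k * g j)                                  ≡⟨ ℚ.*-assoc a (a ^ k) (g j) ⟨
  a ^ suc k * g j                                    ∎
  where open ≡-Reasoning

expₚ : PowerSeries
expₚ = inv!

expₚ≗1+z·expm1-over-z : expₚ ≗ oneₚ +ₚ (1ℚ ·z) ·ₚ expm1-over-z
expₚ≗1+z·expm1-over-z zero    = sym (cong (1ℚ +_) (·z-·ₚ-zero 1ℚ expm1-over-z))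
expₚ≗1+z·expm1-over-z (suc m) = sym (trans (cong (0ℚ +_) (·z-·ₚ-suc 1ℚ expm1-over-z m))
                                           (trans (ℚ.+-identityˡ _) (ℚ.*-identityˡ _)))

sum-zipWith-invList : ∀ (F : ℕ → ℚ → ℚ) m (h : ℕ → ℕ) →
  sum (zipWith F (applyUpTo h (suc m)) (invList m)) ≡ ∑ (suc m) (λ i → F (h i) (z/expm1 (m ∸ i)))
sum-zipWith-invList F zero    h = refl
sum-zipWith-invList F (suc m) h = cong (F (h 0) (z/expm1 (suc m)) +_) (sum-zipWith-invList F m (h ∘ suc))

expm1-over-z·z/expm1≗1 : expm1-over-z ·ₚ z/expm1 ≗ oneₚ
expm1-over-z·z/expm1≗1 zero    = refl
expm1-over-z·z/expm1≗1 (suc m) = begin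
  (expm1-over-z ·ₚ z/expm1) (suc m)
    ≡⟨ ·ₚ-coeff expm1-over-z z/expm1 (suc m) ⟩
  1ℚ * z/expm1 (suc m) + rest
    ≡⟨ cong (λ x → 1ℚ * - x + rest) (sum-zipWith-invList (λ i a → expm1-over-z (suc i) * a) m (λ k → k)) ⟩
  1ℚ * - rest + rest
    ≡⟨ solve 1 (λ s → con 1ℚ :* (:- s) :+ s := con 0ℚ) refl rest ⟩
  0ℚ ∎
  where
  open ≡-Reasoning
  rest = ∑ (suc m) (λ i → expm1-over-z (suc i) * z/expm1 (m ∸ i))

atNegZ : PowerSeries → PowerSeries
atNegZ f m = (- 1ℚ) ^ m * f m

atNegZ-cong : ∀ {f g} → f ≗ g → atNegZ f ≗ atNegZ g
atNegZ-cong f≗g m = cong ((- 1ℚ) ^ m *_) (f≗g m)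

atNegZ-oneₚ : atNegZ oneₚ ≗ oneₚ
atNegZ-oneₚ zero    = refl
atNegZ-oneₚ (suc m) = ℚ.*-zeroʳ ((- 1ℚ) ^ suc m)

atNegZ-homo-· : ∀ f g → atNegZ (f ·ₚ g) ≗ atNegZ f ·ₚ atNegZ g
atNegZ-homo-· f g m = begin
  (- 1ℚ) ^ m * (f ·ₚ g) m                            ≡⟨ cong ((- 1ℚ) ^ m *_) (·ₚ-coeff f g m) ⟩
  (- 1ℚ) ^ m * ∑ (suc m) (λ k → f k * g (m ∸ k))     ≡⟨ *-distribˡ-∑ (suc m) ((- 1ℚ) ^ m) (λ k → f k * g (m ∸ k)) ⟩
  ∑ (suc m) (λ k → (- 1ℚ) ^ m * (f k * g (m ∸ k)))   ≡⟨ ∑-cong-< (suc m) (λ k k<1+m → split-sign k (ℕ.≤-pred k<1+m)) ⟩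
  ∑ (suc m) (λ k → atNegZ f k * atNegZ g (m ∸ k))    ≡⟨ ·ₚ-coeff (atNegZ f) (atNegZ g) m ⟨
  (atNegZ f ·ₚ atNegZ g) m                           ∎
  where
  open ≡-Reasoning
  split-sign : ∀ k → k ≤ m → (- 1ℚ) ^ m * (f k * g (m ∸ k)) ≡ atNegZ f k * atNegZ g (m ∸ k)
  split-sign k k≤m = begin
    (- 1ℚ) ^ m * (f k * g (m ∸ k))
      ≡⟨ cong (λ i → (- 1ℚ) ^ i * (f k * g (m ∸ k))) (ℕ.m+[n∸m]≡n k≤m) ⟨
    (- 1ℚ) ^ (k ℕ.+ (m ∸ k)) * (f k * g (m ∸ k))
      ≡⟨ cong (_* (f k * g (m ∸ k))) (^-homo-* (- 1ℚ) k (m ∸ k)) ⟩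
    ((- 1ℚ) ^ k * (- 1ℚ) ^ (m ∸ k)) * (f k * g (m ∸ k))
      ≡⟨ solve 4 (λ s t a b → (s :* t) :* (a :* b) := (s :* a) :* (t :* b)) refl
                 ((- 1ℚ) ^ k) ((- 1ℚ) ^ (m ∸ k)) (f k) (g (m ∸ k)) ⟩
    atNegZ f k * atNegZ g (m ∸ k) ∎

atNegZ-expm1-over-z·expₚ≗expm1-over-z : atNegZ expm1-over-z ·ₚ expₚ ≗ expm1-over-z
atNegZ-expm1-over-z·expₚ≗expm1-over-z m = begin
  (atNegZ expm1-over-z ·ₚ expₚ) m
    ≡⟨ ·ₚ-coeff (atNegZ expm1-over-z) expₚ m ⟩
  ∑ (suc m) (λ k → (- 1ℚ) ^ k * inv! (suc k) * inv! (m ∸ k))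
    ≡⟨ ∑-cong-< (suc m) (λ k k<1+m → term k (ℕ.≤-pred k<1+m)) ⟩
  ∑ (suc m) (λ k → (- 1ℚ) ^ k * natℚ (suc m C suc k) * inv! (suc m))
    ≡⟨ *-distribʳ-∑ (suc m) (inv! (suc m)) (λ k → (- 1ℚ) ^ k * natℚ (suc m C suc k)) ⟨
  ∑ (suc m) (λ k → (- 1ℚ) ^ k * natℚ (suc m C suc k)) * inv! (suc m)
    ≡⟨ cong (_* inv! (suc m)) (∑-alternating-C-suc m) ⟩
  1ℚ * inv! (suc m)
    ≡⟨ ℚ.*-identityˡ (inv! (suc m)) ⟩
  expm1-over-z m ∎
  where
  open ≡-Reasoning
  term : ∀ k → k ≤ m →
         (- 1ℚ) ^ k * inv! (suc k) * inv! (m ∸ k) ≡ (- 1ℚ) ^ k * natℚ (suc m C suc k) * inv! (suc m)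
  term k k≤m = begin
    (- 1ℚ) ^ k * inv! (suc k) * inv! (m ∸ k)             ≡⟨ ℚ.*-assoc ((- 1ℚ) ^ k) _ _ ⟩
    (- 1ℚ) ^ k * (inv! (suc k) * inv! (m ∸ k))           ≡⟨ cong ((- 1ℚ) ^ k *_) (inv!-suc*inv!≡C*inv! k≤m) ⟩
    (- 1ℚ) ^ k * (natℚ (suc m C suc k) * inv! (suc m))   ≡⟨ ℚ.*-assoc ((- 1ℚ) ^ k) _ _ ⟨
    (- 1ℚ) ^ k * natℚ (suc m C suc k) * inv! (suc m)     ∎

expₚ·z/expm1≗z/expm1+z : expₚ ·ₚ z/expm1 ≗ z/expm1 +ₚ 1ℚ ·z
expₚ·z/expm1≗z/expm1+z = begin
  expₚ ·ₚ b                          ≈⟨ ·ₚ-congʳ b expₚ≗1+z·expm1-over-z ⟩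
  (oneₚ +ₚ (1ℚ ·z) ·ₚ c) ·ₚ b        ≈⟨ ·ₚ-distribʳ b oneₚ ((1ℚ ·z) ·ₚ c) ⟩
  oneₚ ·ₚ b +ₚ ((1ℚ ·z) ·ₚ c) ·ₚ b   ≈⟨ (λ m → cong₂ _+_ (·ₚ-identityˡ b m) (·ₚ-assoc (1ℚ ·z) c b m)) ⟩
  b +ₚ (1ℚ ·z) ·ₚ (c ·ₚ b)           ≈⟨ (λ m → cong (b m +_) (·ₚ-congˡ (1ℚ ·z) expm1-over-z·z/expm1≗1 m)) ⟩
  b +ₚ (1ℚ ·z) ·ₚ oneₚ               ≈⟨ (λ m → cong (b m +_) (·ₚ-identityʳ (1ℚ ·z) m)) ⟩
  b +ₚ 1ℚ ·z                         ∎
  where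
  open import Relation.Binary.Reasoning.Setoid P.setoid
  b = z/expm1
  c = expm1-over-z

atNegZ-z/expm1 : atNegZ z/expm1 ≗ z/expm1 +ₚ 1ℚ ·z
atNegZ-z/expm1 = begin
  atNegZ b                                   ≈⟨ ·ₚ-identityʳ (atNegZ b) ⟨
  atNegZ b ·ₚ oneₚ                           ≈⟨ ·ₚ-congˡ (atNegZ b) c[-z]·[b+z]≗1 ⟨
  atNegZ b ·ₚ (atNegZ c ·ₚ (b +ₚ 1ℚ ·z))     ≈⟨ ·ₚ-assoc (atNegZ b) (atNegZ c) (b +ₚ 1ℚ ·z) ⟨
  (atNegZ b ·ₚ atNegZ c) ·ₚ (b +ₚ 1ℚ ·z)     ≈⟨ ·ₚ-congʳ (b +ₚ 1ℚ ·z) (atNegZ-homo-· b c) ⟨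
  atNegZ (b ·ₚ c) ·ₚ (b +ₚ 1ℚ ·z)            ≈⟨ ·ₚ-congʳ (b +ₚ 1ℚ ·z) [b·c][-z]≗1 ⟩
  oneₚ ·ₚ (b +ₚ 1ℚ ·z)                       ≈⟨ ·ₚ-identityˡ (b +ₚ 1ℚ ·z) ⟩
  b +ₚ 1ℚ ·z                                 ∎
  where
  open import Relation.Binary.Reasoning.Setoid P.setoid
  b = z/expm1
  c = expm1-over-z
  [b·c][-z]≗1 : atNegZ (b ·ₚ c) ≗ oneₚ
  [b·c][-z]≗1 = P.trans (atNegZ-cong (P.trans (·ₚ-comm b c) expm1-over-z·z/expm1≗1)) atNegZ-oneₚ
  c[-z]·[b+z]≗1 : atNegZ c ·ₚ (b +ₚ 1ℚ ·z) ≗ oneₚ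
  c[-z]·[b+z]≗1 = begin
    atNegZ c ·ₚ (b +ₚ 1ℚ ·z)   ≈⟨ ·ₚ-congˡ (atNegZ c) expₚ·z/expm1≗z/expm1+z ⟨
    atNegZ c ·ₚ (expₚ ·ₚ b)    ≈⟨ ·ₚ-assoc (atNegZ c) expₚ b ⟨
    (atNegZ c ·ₚ expₚ) ·ₚ b    ≈⟨ ·ₚ-congʳ b atNegZ-expm1-over-z·expₚ≗expm1-over-z ⟩
    c ·ₚ b                     ≈⟨ expm1-over-z·z/expm1≗1 ⟩
    oneₚ                       ∎

double : ℕ → ℕ
double zero    = zero
double (suc n) = suc (suc (double n))

double≡2* : ∀ n → double n ≡ 2 ℕ.* n
double≡2* zero    = refl
double≡2* (suc n) = trans (cong (suc ∘ suc) (double≡2* n)) (sym (ℕ.*-suc 2 n))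

-1^odd≡-1 : ∀ j → (- 1ℚ) ^ suc (double j) ≡ - 1ℚ
-1^odd≡-1 zero    = refl
-1^odd≡-1 (suc j) = cong (λ x → - 1ℚ * (- 1ℚ * x)) (-1^odd≡-1 j)

z/2·coth[z/2] : PowerSeries
z/2·coth[z/2] = ½ ·z +ₚ z/expm1

z/2·coth[z/2]-odd : ∀ j → z/2·coth[z/2] (suc (double j)) ≡ 0ℚ
z/2·coth[z/2]-odd j = begin
  (½ ·z) m + b        ≡⟨ cong (_+ b) (·z≡*1·z ½ m) ⟩
  ½ * x + b           ≡⟨ solve 2 (λ b x → con ½ :* x :+ b := con ½ :* ((b :+ x) :+ b)) refl b x ⟩
  ½ * ((b + x) + b)   ≡⟨ cong (λ y → ½ * (y + b)) b+x≡-b ⟩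
  ½ * (- b + b)       ≡⟨ cong (½ *_) (ℚ.+-inverseˡ b) ⟩
  ½ * 0ℚ              ≡⟨⟩
  0ℚ                  ∎
  where
  open ≡-Reasoning
  m = suc (double j)
  b = z/expm1 m
  x = (1ℚ ·z) m
  b+x≡-b : b + x ≡ - b
  b+x≡-b = begin
    b + x             ≡⟨ atNegZ-z/expm1 m ⟨
    (- 1ℚ) ^ m * b    ≡⟨ cong (_* b) (-1^odd≡-1 j) ⟩
    - 1ℚ * b          ≡⟨ ℚ.neg-distribˡ-* 1ℚ b ⟨
    - (1ℚ * b)        ≡⟨ cong -_ (ℚ.*-identityˡ b) ⟩
    - b               ∎

-- Substituting z² for z

atZ² : PowerSeries → PowerSeries
atZ² f zero          = f 0
atZ² f (suc zero)    = 0ℚ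
atZ² f (suc (suc m)) = atZ² (f ∘ suc) m

evenPart : PowerSeries → PowerSeries
evenPart f j = f (double j)

atZ²-double : ∀ f j → atZ² f (double j) ≡ f j
atZ²-double f zero    = refl
atZ²-double f (suc j) = atZ²-double (f ∘ suc) j

atZ²-odd : ∀ f j → atZ² f (suc (double j)) ≡ 0ℚ
atZ²-odd f zero    = refl
atZ²-odd f (suc j) = atZ²-odd (f ∘ suc) j

≗-by-parity : ∀ {f g : PowerSeries} → (∀ j → f (double j) ≡ g (double j)) →
              (∀ j → f (suc (double j)) ≡ g (suc (double j))) → f ≗ g
≗-by-parity even odd zero          = even 0
≗-by-parity even odd (suc zero)    = odd 0
≗-by-parity even odd (suc (suc m)) = ≗-by-parity (even ∘ suc) (odd ∘ suc) m

∑-double : ∀ p (f : ℕ → ℚ) → ∑ (double p) f ≡ ∑ p (f ∘ double) + ∑ p (f ∘ suc ∘ double)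
∑-double zero    f = refl
∑-double (suc p) f = trans (cong (λ x → f 0 + (f 1 + x)) (∑-double p (f ∘ suc ∘ suc)))
  (solve 4 (λ a b u v → a :+ (b :+ (u :+ v)) := (a :+ u) :+ (b :+ v)) refl (f 0) (f 1) _ _)

∑-suc-double : ∀ p (f : ℕ → ℚ) → ∑ (suc (double p)) f ≡ ∑ (suc p) (f ∘ double) + ∑ p (f ∘ suc ∘ double)
∑-suc-double p f = trans (cong (f 0 +_) (∑-double p (f ∘ suc)))
  (solve 3 (λ a u v → a :+ (u :+ v) := (a :+ v) :+ u) refl (f 0) _ _)

double∸double : ∀ p i → double p ∸ double i ≡ double (p ∸ i)
double∸double p       zero    = refl
double∸double zero    (suc i) = refl
double∸double (suc p) (suc i) = double∸double p i

suc-double∸double : ∀ {p i} → i ≤ p → suc (double p) ∸ double i ≡ suc (double (p ∸ i))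
suc-double∸double {p}     {zero}  _         = refl
suc-double∸double {suc p} {suc i} (s≤s i≤p) = suc-double∸double i≤p

atZ²-·ₚ-double : ∀ f g p → (atZ² f ·ₚ atZ² g) (double p) ≡ (f ·ₚ g) p
atZ²-·ₚ-double f g p = begin
  (F ·ₚ G) (double p)
    ≡⟨ ·ₚ-coeff F G (double p) ⟩
  ∑ (suc (double p)) (λ k → F k * G (double p ∸ k))
    ≡⟨ ∑-suc-double p (λ k → F k * G (double p ∸ k)) ⟩
  ∑ (suc p) (λ i → F (double i) * G (double p ∸ double i)) + ∑ p (λ i → F (suc (double i)) * G (double p ∸ suc (double i)))
    ≡⟨ cong₂ _+_ (∑-cong (suc p) even-term) (∑-zero p (λ i _ → odd-term i)) ⟩
  ∑ (suc p) (λ i → f i * g (p ∸ i)) + 0ℚ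
    ≡⟨ ℚ.+-identityʳ _ ⟩
  ∑ (suc p) (λ i → f i * g (p ∸ i))
    ≡⟨ ·ₚ-coeff f g p ⟨
  (f ·ₚ g) p ∎
  where
  open ≡-Reasoning
  F = atZ² f
  G = atZ² g
  even-term : ∀ i → F (double i) * G (double p ∸ double i) ≡ f i * g (p ∸ i)
  even-term i = cong₂ _*_ (atZ²-double f i) (trans (cong G (double∸double p i)) (atZ²-double g (p ∸ i)))
  odd-term : ∀ i → F (suc (double i)) * G (double p ∸ suc (double i)) ≡ 0ℚ
  odd-term i = trans (cong (_* G (double p ∸ suc (double i))) (atZ²-odd f i)) (ℚ.*-zeroˡ (G (double p ∸ suc (double i))))

atZ²-·ₚ-odd : ∀ f g p → (atZ² f ·ₚ atZ² g) (suc (double p)) ≡ 0ℚ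
atZ²-·ₚ-odd f g p = begin
  (F ·ₚ G) m
    ≡⟨ ·ₚ-coeff F G m ⟩
  ∑ (double (suc p)) (λ k → F k * G (m ∸ k))
    ≡⟨ ∑-double (suc p) (λ k → F k * G (m ∸ k)) ⟩
  ∑ (suc p) (λ i → F (double i) * G (m ∸ double i)) + ∑ (suc p) (λ i → F (suc (double i)) * G (m ∸ suc (double i)))
    ≡⟨ cong₂ _+_ (∑-zero (suc p) (λ i i<1+p → even-term i (ℕ.≤-pred i<1+p))) (∑-zero (suc p) (λ i _ → odd-term i)) ⟩
  0ℚ + 0ℚ
    ≡⟨⟩
  0ℚ ∎
  where
  open ≡-Reasoning
  m = suc (double p)
  F = atZ² f
  G = atZ² g
  even-term : ∀ i → i ≤ p → F (double i) * G (m ∸ double i) ≡ 0ℚ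
  even-term i i≤p = trans (cong (F (double i) *_) (trans (cong G (suc-double∸double i≤p)) (atZ²-odd g (p ∸ i))))
                          (ℚ.*-zeroʳ (F (double i)))
  odd-term : ∀ i → F (suc (double i)) * G (m ∸ suc (double i)) ≡ 0ℚ
  odd-term i = trans (cong (_* G (m ∸ suc (double i))) (atZ²-odd f i)) (ℚ.*-zeroˡ (G (m ∸ suc (double i))))

atZ²-homo-· : ∀ f g → atZ² (f ·ₚ g) ≗ atZ² f ·ₚ atZ² g
atZ²-homo-· f g = ≗-by-parity
  (λ p → trans (atZ²-double (f ·ₚ g) p) (sym (atZ²-·ₚ-double f g p)))
  (λ p → trans (atZ²-odd (f ·ₚ g) p) (sym (atZ²-·ₚ-odd f g p)))

atZ²-oneₚ : atZ² oneₚ ≗ oneₚ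
atZ²-oneₚ = ≗-by-parity (λ j → trans (atZ²-double oneₚ j) (oneₚ-double j)) (atZ²-odd oneₚ)
  where
  oneₚ-double : ∀ j → oneₚ j ≡ oneₚ (double j)
  oneₚ-double zero    = refl
  oneₚ-double (suc j) = refl

atZ²-homo-^ : ∀ f n → atZ² (f ^ₚ n) ≗ atZ² f ^ₚ n
atZ²-homo-^ f zero    = atZ²-oneₚ
atZ²-homo-^ f (suc n) = P.trans (atZ²-homo-· f (f ^ₚ n)) (·ₚ-congˡ (atZ² f) (atZ²-homo-^ f n))

atZ²-evenPart : ∀ f → (∀ j → f (suc (double j)) ≡ 0ℚ) → atZ² (evenPart f) ≗ f
atZ²-evenPart f odd≡0 =
  ≗-by-parity (atZ²-double (evenPart f)) (λ j → trans (atZ²-odd (evenPart f) j) (sym (odd≡0 j)))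

evenPart-^ₚ : ∀ f → (∀ j → f (suc (double j)) ≡ 0ℚ) →
              ∀ N n → (evenPart f ^ₚ N) n ≡ (f ^ₚ N) (double n)
evenPart-^ₚ f odd≡0 N n = begin
  (evenPart f ^ₚ N) n                   ≡⟨ atZ²-double (evenPart f ^ₚ N) n ⟨
  atZ² (evenPart f ^ₚ N) (double n)     ≡⟨ atZ²-homo-^ (evenPart f) N (double n) ⟩
  (atZ² (evenPart f) ^ₚ N) (double n)   ≡⟨ ^ₚ-cong (atZ²-evenPart f odd≡0) N (double n) ⟩
  (f ^ₚ N) (double n)                   ∎
  where open ≡-Reasoning

-- Sums over compositions

sum-++ : ∀ xs ys → sum (xs ++ ys) ≡ sum xs + sum ys
sum-++ []       ys = sym (ℚ.+-identityˡ (sum ys))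
sum-++ (x ∷ xs) ys = trans (cong (x +_) (sum-++ xs ys)) (sym (ℚ.+-assoc x (sum xs) (sum ys)))

sum-map-concatMap : ∀ {A B : Set} (φ : B → ℚ) (g : A → List B) xs →
  sum (map φ (concatMap g xs)) ≡ sum (map (λ x → sum (map φ (g x))) xs)
sum-map-concatMap φ g []       = refl
sum-map-concatMap φ g (x ∷ xs) = begin
  sum (map φ (g x ++ concatMap g xs))                          ≡⟨ cong sum (List.map-++ φ (g x) (concatMap g xs)) ⟩
  sum (map φ (g x) ++ map φ (concatMap g xs))                  ≡⟨ sum-++ (map φ (g x)) (map φ (concatMap g xs)) ⟩
  sum (map φ (g x)) + sum (map φ (concatMap g xs))             ≡⟨ cong (sum (map φ (g x)) +_) (sum-map-concatMap φ g xs) ⟩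
  sum (map φ (g x)) + sum (map (λ y → sum (map φ (g y))) xs)   ∎
  where open ≡-Reasoning

*-distribˡ-sum-map : ∀ {A : Set} x (g : A → ℚ) xs → x * sum (map g xs) ≡ sum (map (λ a → x * g a) xs)
*-distribˡ-sum-map x g []       = ℚ.*-zeroʳ x
*-distribˡ-sum-map x g (a ∷ xs) =
  trans (ℚ.*-distribˡ-+ x (g a) _) (cong (x * g a +_) (*-distribˡ-sum-map x g xs))

product-map-* : ∀ (u v : ℕ → ℚ) xs →
                product (map u xs) * product (map v xs) ≡ product (map (λ j → u j * v j) xs)
product-map-* u v []       = refl
product-map-* u v (x ∷ xs) = trans
  (solve 4 (λ a b p q → (a :* p) :* (b :* q) := (a :* b) :* (p :* q)) refl
           (u x) (v x) (product (map u xs)) (product (map v xs)))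
  (cong (u x * v x *_) (product-map-* u v xs))

sum-compositions : ∀ (f : PowerSeries) N n →
  sum (map (λ v → product (map f (toList v))) (compositions N n)) ≡ (f ^ₚ N) n
sum-compositions f zero    zero    = refl
sum-compositions f zero    (suc n) = refl
sum-compositions f (suc N) n = begin
  sum (map Πf (concatMap (λ j → map (j Vec.∷_) (compositions N (n ∸ j))) (upTo (suc n))))
    ≡⟨ sum-map-concatMap Πf (λ j → map (j Vec.∷_) (compositions N (n ∸ j))) (upTo (suc n)) ⟩
  sum (map (λ j → sum (map Πf (map (j Vec.∷_) (compositions N (n ∸ j))))) (upTo (suc n)))
    ≡⟨ cong sum (List.map-cong first-part (upTo (suc n))) ⟩
  sum (map (λ j → f j * (f ^ₚ N) (n ∸ j)) (upTo (suc n))) ∎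
  where
  open ≡-Reasoning
  Πf : ∀ {N} → Vec ℕ N → ℚ
  Πf v = product (map f (toList v))
  first-part : ∀ j → sum (map Πf (map (j Vec.∷_) (compositions N (n ∸ j)))) ≡ f j * (f ^ₚ N) (n ∸ j)
  first-part j = begin
    sum (map Πf (map (j Vec.∷_) (compositions N (n ∸ j))))   ≡⟨ cong sum (List.map-∘ (compositions N (n ∸ j))) ⟨
    sum (map (λ v → f j * Πf v) (compositions N (n ∸ j)))    ≡⟨ *-distribˡ-sum-map (f j) Πf (compositions N (n ∸ j)) ⟨
    f j * sum (map Πf (compositions N (n ∸ j)))              ≡⟨ cong (f j *_) (sum-compositions f N (n ∸ j)) ⟩
    f j * (f ^ₚ N) (n ∸ j)                                   ∎

inv!*bernoulli : ∀ m → inv! m * bernoulli m ≡ z/expm1 m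
inv!*bernoulli m = begin
  inv! m * (natℚ (m !) * (z/expm1 ·ₚ oneₚ) m)
    ≡⟨ ℚ.*-assoc (inv! m) _ _ ⟨
  (inv! m * natℚ (m !)) * (z/expm1 ·ₚ oneₚ) m
    ≡⟨ cong₂ _*_ (inv*natℚ≡1 (m !) {{m ℕ.!≢0}}) (·ₚ-identityʳ z/expm1 m) ⟩
  1ℚ * z/expm1 m
    ≡⟨ ℚ.*-identityˡ (z/expm1 m) ⟩
  z/expm1 m ∎
  where open ≡-Reasoning

S≡[2n]!*evenPart^N : ∀ N n → S N n ≡ natℚ ((2 ℕ.* n) !) * (evenPart z/2·coth[z/2] ^ₚ N) n
S≡[2n]!*evenPart^N N n = begin
  S N n
    ≡⟨ cong sum (List.map-cong summand (compositions N n)) ⟩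
  sum (map (λ v → [2n]! * Πf v) (compositions N n))
    ≡⟨ *-distribˡ-sum-map [2n]! Πf (compositions N n) ⟨
  [2n]! * sum (map Πf (compositions N n))
    ≡⟨ cong ([2n]! *_) (sum-compositions f N n) ⟩
  [2n]! * (f ^ₚ N) n ∎
  where
  open ≡-Reasoning
  [2n]! = natℚ ((2 ℕ.* n) !)
  f = evenPart z/2·coth[z/2]
  Πf : Vec ℕ N → ℚ
  Πf v = product (map f (toList v))
  factor : ∀ j → inv! (2 ℕ.* j) * bernoulli (2 ℕ.* j) ≡ f j
  factor j = begin
    inv! (2 ℕ.* j) * bernoulli (2 ℕ.* j)   ≡⟨ inv!*bernoulli (2 ℕ.* j) ⟩
    z/expm1 (2 ℕ.* j)                      ≡⟨ cong z/expm1 (double≡2* j) ⟨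
    z/expm1 (double j)                     ≡⟨ ℚ.+-identityˡ _ ⟨
    0ℚ + z/expm1 (double j)                ≡⟨ cong (_+ z/expm1 (double j)) (½z-even j) ⟩
    f j                                    ∎
    where
    ½z-even : ∀ j → 0ℚ ≡ (½ ·z) (double j)
    ½z-even zero    = refl
    ½z-even (suc j) = refl
  summand : ∀ v → multinomial2 N n v * product (map (λ j → bernoulli (2 ℕ.* j)) (toList v)) ≡ [2n]! * Πf v
  summand v = begin
    [2n]! * product (map (λ j → inv! (2 ℕ.* j)) l) * product (map (λ j → bernoulli (2 ℕ.* j)) l)
      ≡⟨ ℚ.*-assoc [2n]! _ _ ⟩
    [2n]! * (product (map (λ j → inv! (2 ℕ.* j)) l) * product (map (λ j → bernoulli (2 ℕ.* j)) l))
      ≡⟨ cong ([2n]! *_) (product-map-* (λ j → inv! (2 ℕ.* j)) (λ j → bernoulli (2 ℕ.* j)) l) ⟩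
    [2n]! * product (map (λ j → inv! (2 ℕ.* j) * bernoulli (2 ℕ.* j)) l)
      ≡⟨ cong (λ xs → [2n]! * product xs) (List.map-cong factor l) ⟩
    [2n]! * Πf v ∎
    where l = toList v

½^≡inv[2^] : ∀ k → ½ ^ k ≡ inv (2 ℕ.^ k) {{ℕ.m^n≢0 2 k}}
½^≡inv[2^] zero    = refl
½^≡inv[2^] (suc k) = trans (cong (½ *_) (½^≡inv[2^] k)) (sym (inv-homo-* 2 (2 ℕ.^ k) {{_}} {{ℕ.m^n≢0 2 k}}))

binomial-summand : ∀ N T k → k ≤ T →
  natℚ (T !) * (natℚ (N C k) * (((½ ·z) ^ₚ k) ·ₚ (z/expm1 ^ₚ (N ∸ k))) T)
    ≡ natℚ (T P k) * inv (2 ℕ.^ k) {{ℕ.m^n≢0 2 k}} * natℚ (N C k) * bernoulliGen (N ∸ k) (T ∸ k)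
binomial-summand N T k k≤T = begin
  natℚ (T !) * (natℚ (N C k) * (((½ ·z) ^ₚ k) ·ₚ g) T)
    ≡⟨ cong (λ i → natℚ (T !) * (natℚ (N C k) * (((½ ·z) ^ₚ k) ·ₚ g) i)) (ℕ.m+[n∸m]≡n k≤T) ⟨
  natℚ (T !) * (natℚ (N C k) * (((½ ·z) ^ₚ k) ·ₚ g) (k ℕ.+ (T ∸ k)))
    ≡⟨ cong₂ (λ x y → x * (natℚ (N C k) * y)) T!≡TPk*[T∸k]! (·z^ₚ-·ₚ ½ k g (T ∸ k)) ⟩
  (natℚ (T P k) * natℚ ((T ∸ k) !)) * (natℚ (N C k) * (½ ^ k * g (T ∸ k)))
    ≡⟨ solve 5 (λ p f c i y → (p :* f) :* (c :* (i :* y)) := p :* i :* c :* (f :* y)) refl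
               (natℚ (T P k)) (natℚ ((T ∸ k) !)) (natℚ (N C k)) (½ ^ k) (g (T ∸ k)) ⟩
  natℚ (T P k) * ½ ^ k * natℚ (N C k) * bernoulliGen (N ∸ k) (T ∸ k)
    ≡⟨ cong (λ x → natℚ (T P k) * x * natℚ (N C k) * bernoulliGen (N ∸ k) (T ∸ k)) (½^≡inv[2^] k) ⟩
  natℚ (T P k) * inv (2 ℕ.^ k) {{ℕ.m^n≢0 2 k}} * natℚ (N C k) * bernoulliGen (N ∸ k) (T ∸ k) ∎
  where
  open ≡-Reasoning
  g = z/expm1 ^ₚ (N ∸ k)
  T!≡TPk*[T∸k]! : natℚ (T !) ≡ natℚ (T P k) * natℚ ((T ∸ k) !)
  T!≡TPk*[T∸k]! = trans (cong natℚ (sym (nPk*[n∸k]!≡n! k≤T))) (natℚ-homo-* (T P k) ((T ∸ k) !))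

proposition5p1 : (N n : ℕ) → 1 ≤ N → N < 2 ℕ.* n → S N n ≡ RHS N n
proposition5p1 N n _ N<2n = begin
  S N n                                          ≡⟨ S≡[2n]!*evenPart^N N n ⟩
  [2n]! * (evenPart z/2·coth[z/2] ^ₚ N) n        ≡⟨ cong ([2n]! *_) (evenPart-^ₚ z/2·coth[z/2] z/2·coth[z/2]-odd N n) ⟩
  [2n]! * (z/2·coth[z/2] ^ₚ N) (double n)        ≡⟨ cong (λ i → [2n]! * (z/2·coth[z/2] ^ₚ N) i) (double≡2* n) ⟩
  [2n]! * (z/2·coth[z/2] ^ₚ N) T                 ≡⟨ cong ([2n]! *_) (^ₚ-binomial-coeff (½ ·z) z/expm1 N T) ⟩
  [2n]! * ∑ (suc N) binomialTerm                 ≡⟨ *-distribˡ-∑ (suc N) [2n]! binomialTerm ⟩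
  ∑ (suc N) (λ k → [2n]! * binomialTerm k)       ≡⟨ ∑-cong-< (suc N) (λ k k<1+N → binomial-summand N T k (k≤T k<1+N)) ⟩
  ∑ (suc N) rhsTerm                              ≡⟨ sum-map-upTo rhsTerm (suc N) ⟨
  RHS N n                                        ∎
  where
  open ≡-Reasoning
  T = 2 ℕ.* n
  [2n]! = natℚ (T !)
  k≤T : ∀ {k} → k < suc N → k ≤ T
  k≤T k<1+N = ℕ.≤-trans (ℕ.≤-pred k<1+N) (ℕ.<⇒≤ N<2n)
  binomialTerm : ℕ → ℚ
  binomialTerm k = natℚ (N C k) * (((½ ·z) ^ₚ k) ·ₚ (z/expm1 ^ₚ (N ∸ k))) T
  rhsTerm : ℕ → ℚ
  rhsTerm k = natℚ (T P k) * inv (2 ℕ.^ k) {{ℕ.m^n≢0 2 k}} * natℚ (N C k) * bernoulliGen (N ∸ k) (T ∸ k)
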